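{- For every $\alpha\leq\omega$, the relation $\mathcal{L}^{\alpha}$ on closed $\mu$TCL terms is a congruence on the term algebra $\mathrm{Tr}$; that is, for every operation symbol $\mathsf{f}\colon \tau_1\times\cdots\times\tau_k\to\tau$ of the signature and all closed terms $t_i,s_i$ of type $\tau_i$ with $\mathcal{L}^\alpha_{\tau_i}(t_i,s_i)$ for $i=1,\dots,k$, one has $\mathcal{L}^\alpha_\tau(\mathsf{f}(t_1,\dots,t_k),\mathsf{f}(s_1,\dots,s_k))$.
   Context: Types of $\mu$TCL: closed type expressions, modulo $\alpha$-equivalence, of the grammar $\tau::=\alpha\mid \tau_1\boxplus\tau_2\mid\tau_1\boxtimes\tau_2\mid \tau_1\Rightarrow\tau_2\mid \mu\alpha.\tau$ ($\alpha$ ranging over type variables); $\tau[\sigma/\alpha]$ is capture-avoiding substitution. $\mathrm{Tr}$ is the type-indexed set of closed terms over the following many-sorted signature (type indices range over all closed types, $\tau$ in fold/unfold over types with at most $\alpha$ free): constants $S_{\tau_1,\tau_2,\tau_3}\colon(\tau_1\Rightarrow\tau_2\Rightarrow\tau_3)\Rightarrow(\tau_1\Rightarrow\tau_2)\Rightarrow\tau_1\Rightarrow\tau_3$, $K_{\tau_1,\tau_2}\colon \tau_1\Rightarrow\tau_2\Rightarrow\tau_1$, $I_\tau\colon\tau\Rightarrow\tau$; operations $S'\colon(\tau_1\Rightarrow\tau_2\Rightarrow\tau_3)\to((\tau_1\Rightarrow\tau_2)\Rightarrow\tau_1\Rightarrow\tau_3)$, $S''\colon (\tau_1\Rightarrow\tau_2\Rightarrow\tau_3)\times(\tau_1\Rightarrow\tau_2)\to(\tau_1\Rightarrow\tau_3)$,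 $K'\colon\tau_1\to(\tau_2\Rightarrow\tau_1)$, application $\mathsf{app}\colon(\tau_1\Rightarrow\tau_2)\times\tau_1\to\tau_2$ (written $t\,s$), $\mathsf{inl}\colon\tau_1\to\tau_1\boxplus\tau_2$, $\mathsf{inr}\colon\tau_2\to\tau_1\boxplus\tau_2$, $\mathsf{case}\colon(\tau_1\boxplus\tau_2)\times(\tau_1\Rightarrow\tau_3)\times(\tau_2\Rightarrow\tau_3)\to\tau_3$, $\mathsf{pair}\colon\tau_1\times\tau_2\to\tau_1\boxtimes\tau_2$, $\mathsf{fst}\colon\tau_1\boxtimes\tau_2\to\tau_1$, $\mathsf{snd}\colon\tau_1\boxtimes\tau_2\to\tau_2$, $\mathsf{fold}_\tau\colon\tau[\mu\alpha.\tau/\alpha]\to\mu\alpha.\tau$, $\mathsf{unfold}_\tau\colon\mu\alpha.\tau\to\tau[\mu\alpha.\tau/\alpha]$. Transitions on closed terms are exactly those derivable by the rules (for all appropriately typed closed $e,t,t',s,r$): $S\xrightarrow{e}S'(e)$; $S'(t)\xrightarrow{e}S''(t,e)$; $S''(t,s)\xrightarrow{e}(t\,e)(s\,e)$; $K\xrightarrow{e}K'(e)$; $K'(t)\xrightarrow{e}t$; $I\xrightarrow{e}e$; if $t\to t'$ then $t\,s\to t'\,s$; if $t\xrightarrow{s}t'$ then $t\,s\to t'$; $\mathsf{inl}(t)\xrightarrow{\boxplus_1}t$; $\mathsf{inr}(t)\xrightarrow{\boxplus_2}t$; if $t\to t'$ then $\mathsf{case}(t,s,r)\to\mathsf{case}(t',s,r)$;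 if $t\xrightarrow{\boxplus_1}t'$ then $\mathsf{case}(t,s,r)\to s\,t'$; if $t\xrightarrow{\boxplus_2}t'$ then $\mathsf{case}(t,s,r)\to r\,t'$; $\mathsf{pair}(t,s)\xrightarrow{\boxtimes_1}t$; $\mathsf{pair}(t,s)\xrightarrow{\boxtimes_2}s$; if $t\to t'$ then $\mathsf{fst}(t)\to\mathsf{fst}(t')$ and $\mathsf{snd}(t)\to\mathsf{snd}(t')$; if $t\xrightarrow{\boxtimes_1}t'$ then $\mathsf{fst}(t)\to t'$; if $t\xrightarrow{\boxtimes_2}t'$ then $\mathsf{snd}(t)\to t'$; $\mathsf{fold}(t)\xrightarrow{\mu}t$; if $t\to t'$ then $\mathsf{unfold}(t)\to\mathsf{unfold}(t')$; if $t\xrightarrow{\mu}t'$ then $\mathsf{unfold}(t)\to t'$. Weak transitions: $\Rightarrow$ is the reflexive transitive closure of $\to$; $t\overset{l}{\Rightarrow}s$ iff $t\Rightarrow t'\xrightarrow{l}s$ for some $t'$. Relations on $\mathrm{Tr}$ are type-indexed families $R=(R_\tau\subseteq\mathrm{Tr}_\tau\times\mathrm{Tr}_\tau)$. Define $\mathcal{E}(R)_\tau=\{(t,s)\mid t\to t'\implies\exists s'.\,s\Rightarrow s'\wedge R_\tau(t',s')\}$ and $\mathcal{V}(Q,R)$ by: $\mathcal{V}_{\tau_1\boxplus\tau_2}(Q,R)=\{(t,s)\mid$ for $i=1,2$: $t\xrightarrow{\boxplus_i}t'\implies\exists s'.\,s\overset{\boxplus_i}{\Rightarrow}s'\wedge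 R_{\tau_i}(t',s')\}$; $\mathcal{V}_{\tau_1\boxtimes\tau_2}(Q,R)=\{(t,s)\mid t\xrightarrow{\boxtimes_1}t_1\wedge t\xrightarrow{\boxtimes_2}t_2\implies \exists s_1,s_2.\,s\overset{\boxtimes_1}{\Rightarrow}s_1\wedge s\overset{\boxtimes_2}{\Rightarrow}s_2\wedge R_{\tau_1}(t_1,s_1)\wedge R_{\tau_2}(t_2,s_2)\}$; $\mathcal{V}_{\tau_1\Rightarrow\tau_2}(Q,R)=\{(t,s)\mid$ for all $e_1,e_2$ with $Q_{\tau_1}(e_1,e_2)$: $t\xrightarrow{e_1}t'\implies\exists s'.\,s\overset{e_2}{\Rightarrow}s'\wedge R_{\tau_2}(t',s')\}$; $\mathcal{V}_{\mu\alpha.\tau}(Q,R)=\{(t,s)\mid t\xrightarrow{\mu}t'\implies\exists s'.\,s\overset{\mu}{\Rightarrow}s'\wedge R_{\tau[\mu\alpha.\tau/\alpha]}(t',s')\}$. The step-indexed logical relation: $\mathcal{L}^0=$ full relation, $\mathcal{L}^{n+1}=\mathcal{L}^n\cap\mathcal{E}(\mathcal{L}^n)\cap\mathcal{V}(\mathcal{L}^n,\mathcal{L}^n)$, $\mathcal{L}^\omega=\bigcap_{n<\omega}\mathcal{L}^n$. -}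

module Defs where

open import Data.Nat using (ℕ; zero; suc)
open import Data.Fin using (Fin; zero; suc)
open import Data.Unit using (⊤)
open import Data.Product using (Σ; ∃; ∃₂; _×_; _,_)
open import Relation.Binary.Construct.Closure.ReflexiveTransitive using (Star)

-- Types of μTCL.  Type expressions with at most n free type variables,
-- in de Bruijn form (so α-equivalent expressions are literally equal).

infixr 20 _⇒_
infixr 25 _⊞_
infixr 26 _⊠_

data Ty (n : ℕ) : Set where
  var : Fin n → Ty n
  _⊞_ : Ty n → Ty n → Ty n
  _⊠_ : Ty n → Ty n → Ty n
  _⇒_ : Ty n → Ty n → Ty n
  μ   : Ty (suc n) → Ty n

Type : Set
Type = Ty 0

ext : ∀ {m n} → (Fin m → Fin n) → Fin (suc m) → Fin (suc n)
ext ρ zero    = zero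
ext ρ (suc x) = suc (ρ x)

ren : ∀ {m n} → (Fin m → Fin n) → Ty m → Ty n
ren ρ (var x)   = var (ρ x)
ren ρ (a ⊞ b)   = ren ρ a ⊞ ren ρ b
ren ρ (a ⊠ b)   = ren ρ a ⊠ ren ρ b
ren ρ (a ⇒ b)   = ren ρ a ⇒ ren ρ b
ren ρ (μ a)     = μ (ren (ext ρ) a)

exts : ∀ {m n} → (Fin m → Ty n) → Fin (suc m) → Ty (suc n)
exts σ zero    = var zero
exts σ (suc x) = ren suc (σ x)

sub : ∀ {m n} → (Fin m → Ty n) → Ty m → Ty n
sub σ (var x) = σ x
sub σ (a ⊞ b) = sub σ a ⊞ sub σ b
sub σ (a ⊠ b) = sub σ a ⊠ sub σ b
sub σ (a ⇒ b) = sub σ a ⇒ sub σ b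
sub σ (μ a)   = μ (sub (exts σ) a)

sub0 : Type → Fin 1 → Type
sub0 σ zero = σ
sub0 σ (suc ())

_[_] : Ty 1 → Type → Type
τ [ σ ] = sub (sub0 σ) τ

data Tr : Type → Set where
  S    : ∀ {a b c} → Tr ((a ⇒ b ⇒ c) ⇒ (a ⇒ b) ⇒ a ⇒ c)
  K    : ∀ {a b} → Tr (a ⇒ b ⇒ a)
  I    : ∀ {a} → Tr (a ⇒ a)
  S'   : ∀ {a b c} → Tr (a ⇒ b ⇒ c) → Tr ((a ⇒ b) ⇒ a ⇒ c)
  S''  : ∀ {a b c} → Tr (a ⇒ b ⇒ c) → Tr (a ⇒ b) → Tr (a ⇒ c)
  K'   : ∀ {a b} → Tr a → Tr (b ⇒ a)
  app  : ∀ {a b} → Tr (a ⇒ b) → Tr a → Tr b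
  inl  : ∀ {a b} → Tr a → Tr (a ⊞ b)
  inr  : ∀ {a b} → Tr b → Tr (a ⊞ b)
  case : ∀ {a b c} → Tr (a ⊞ b) → Tr (a ⇒ c) → Tr (b ⇒ c) → Tr c
  pair : ∀ {a b} → Tr a → Tr b → Tr (a ⊠ b)
  fst  : ∀ {a b} → Tr (a ⊠ b) → Tr a
  snd  : ∀ {a b} → Tr (a ⊠ b) → Tr b
  fold   : ∀ {τ : Ty 1} → Tr (τ [ μ τ ]) → Tr (μ τ)
  unfold : ∀ {τ : Ty 1} → Tr (μ τ) → Tr (τ [ μ τ ])

data _─[_]→_ : ∀ {a b} → Tr (a ⇒ b) → Tr a → Tr b → Set where
  S-step   : ∀ {a b c} {e : Tr (a ⇒ b ⇒ c)} → S ─[ e ]→ S' e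
  S'-step  : ∀ {a b c} {t : Tr (a ⇒ b ⇒ c)} {e : Tr (a ⇒ b)} → S' t ─[ e ]→ S'' t e
  S''-step : ∀ {a b c} {t : Tr (a ⇒ b ⇒ c)} {s : Tr (a ⇒ b)} {e : Tr a} →
             S'' t s ─[ e ]→ app (app t e) (app s e)
  K-step   : ∀ {a b} {e : Tr a} → K {a} {b} ─[ e ]→ K' e
  K'-step  : ∀ {a b} {t : Tr a} {e : Tr b} → K' t ─[ e ]→ t
  I-step   : ∀ {a} {e : Tr a} → I ─[ e ]→ e

data _─⊞₁→_ : ∀ {a b} → Tr (a ⊞ b) → Tr a → Set where
  inl-step : ∀ {a b} {t : Tr a} → inl {a} {b} t ─⊞₁→ t

data _─⊞₂→_ : ∀ {a b} → Tr (a ⊞ b) → Tr b → Set where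
  inr-step : ∀ {a b} {t : Tr b} → inr {a} {b} t ─⊞₂→ t

data _─⊠₁→_ : ∀ {a b} → Tr (a ⊠ b) → Tr a → Set where
  pair-step₁ : ∀ {a b} {t : Tr a} {s : Tr b} → pair t s ─⊠₁→ t

data _─⊠₂→_ : ∀ {a b} → Tr (a ⊠ b) → Tr b → Set where
  pair-step₂ : ∀ {a b} {t : Tr a} {s : Tr b} → pair t s ─⊠₂→ s

data _─μ→_ {τ : Ty 1} : Tr (μ τ) → Tr (τ [ μ τ ]) → Set where
  fold-step : ∀ {t : Tr (τ [ μ τ ])} → fold t ─μ→ t

data _⟶_ : ∀ {a} → Tr a → Tr a → Set where
  app-l     : ∀ {a b} {t t' : Tr (a ⇒ b)} {s : Tr a} → t ⟶ t' → app t s ⟶ app t' s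
  app-β     : ∀ {a b} {t : Tr (a ⇒ b)} {s : Tr a} {t' : Tr b} → t ─[ s ]→ t' → app t s ⟶ t'
  case-l    : ∀ {a b c} {t t' : Tr (a ⊞ b)} {s : Tr (a ⇒ c)} {r : Tr (b ⇒ c)} →
              t ⟶ t' → case t s r ⟶ case t' s r
  case-inl  : ∀ {a b c} {t : Tr (a ⊞ b)} {t' : Tr a} {s : Tr (a ⇒ c)} {r : Tr (b ⇒ c)} →
              t ─⊞₁→ t' → case t s r ⟶ app s t'
  case-inr  : ∀ {a b c} {t : Tr (a ⊞ b)} {t' : Tr b} {s : Tr (a ⇒ c)} {r : Tr (b ⇒ c)} →
              t ─⊞₂→ t' → case t s r ⟶ app r t'
  fst-l     : ∀ {a b} {t t' : Tr (a ⊠ b)} → t ⟶ t' → fst t ⟶ fst t'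
  snd-l     : ∀ {a b} {t t' : Tr (a ⊠ b)} → t ⟶ t' → snd t ⟶ snd t'
  fst-β     : ∀ {a b} {t : Tr (a ⊠ b)} {t' : Tr a} → t ─⊠₁→ t' → fst t ⟶ t'
  snd-β     : ∀ {a b} {t : Tr (a ⊠ b)} {t' : Tr b} → t ─⊠₂→ t' → snd t ⟶ t'
  unfold-l  : ∀ {τ : Ty 1} {t t' : Tr (μ τ)} → t ⟶ t' → unfold t ⟶ unfold t'
  unfold-β  : ∀ {τ : Ty 1} {t : Tr (μ τ)} {t' : Tr (τ [ μ τ ])} → _─μ→_ {τ} t t' → unfold t ⟶ t'

_⟶*_ : ∀ {a} → Tr a → Tr a → Set
_⟶*_ {a} = Star (_⟶_ {a})

_=[_]⇒_ : ∀ {a b} → Tr (a ⇒ b) → Tr a → Tr b → Set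
t =[ e ]⇒ s = ∃ λ t' → t ⟶* t' × t' ─[ e ]→ s

_=⊞₁⇒_ : ∀ {a b} → Tr (a ⊞ b) → Tr a → Set
t =⊞₁⇒ s = ∃ λ t' → t ⟶* t' × t' ─⊞₁→ s

_=⊞₂⇒_ : ∀ {a b} → Tr (a ⊞ b) → Tr b → Set
t =⊞₂⇒ s = ∃ λ t' → t ⟶* t' × t' ─⊞₂→ s

_=⊠₁⇒_ : ∀ {a b} → Tr (a ⊠ b) → Tr a → Set
t =⊠₁⇒ s = ∃ λ t' → t ⟶* t' × t' ─⊠₁→ s

_=⊠₂⇒_ : ∀ {a b} → Tr (a ⊠ b) → Tr b → Set
t =⊠₂⇒ s = ∃ λ t' → t ⟶* t' × t' ─⊠₂→ s

_=μ⇒_ : ∀ {τ : Ty 1} → Tr (μ τ) → Tr (τ [ μ τ ]) → Set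
_=μ⇒_ {τ} t s = ∃ λ t' → t ⟶* t' × _─μ→_ {τ} t' s

TRel : Set₁
TRel = (a : Type) → Tr a → Tr a → Set

𝓔 : TRel → TRel
𝓔 R a t s = ∀ t' → t ⟶ t' → ∃ λ s' → s ⟶* s' × R a t' s'

𝓥 : TRel → TRel → TRel
𝓥 Q R (var ())
𝓥 Q R (a ⊞ b) t s =
  (∀ t' → t ─⊞₁→ t' → ∃ λ s' → s =⊞₁⇒ s' × R a t' s') ×
  (∀ t' → t ─⊞₂→ t' → ∃ λ s' → s =⊞₂⇒ s' × R b t' s')
𝓥 Q R (a ⊠ b) t s =
  ∀ t₁ t₂ → t ─⊠₁→ t₁ → t ─⊠₂→ t₂ →
  ∃₂ λ s₁ s₂ → s =⊠₁⇒ s₁ × s =⊠₂⇒ s₂ × R a t₁ s₁ × R b t₂ s₂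
𝓥 Q R (a ⇒ b) t s =
  ∀ e₁ e₂ → Q a e₁ e₂ → ∀ t' → t ─[ e₁ ]→ t' → ∃ λ s' → s =[ e₂ ]⇒ s' × R b t' s'
𝓥 Q R (μ τ) t s =
  ∀ t' → _─μ→_ {τ} t t' → ∃ λ s' → _=μ⇒_ {τ} s s' × R (τ [ μ τ ]) t' s'

𝓛ⁿ : ℕ → TRel
𝓛ⁿ zero    a t s = ⊤
𝓛ⁿ (suc n) a t s = 𝓛ⁿ n a t s × 𝓔 (𝓛ⁿ n) a t s × 𝓥 (𝓛ⁿ n) (𝓛ⁿ n) a t s

data Ord≤ω : Set where
  fin : ℕ → Ord≤ω
  ω   : Ord≤ω

𝓛 : Ord≤ω → TRel
𝓛 (fin n) = 𝓛ⁿ n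
𝓛 ω a t s = ∀ n → 𝓛ⁿ n a t s

record Congruence (R : TRel) : Set where
  field
    S-cong    : ∀ {a b c} → R _ (S {a} {b} {c}) S
    K-cong    : ∀ {a b} → R _ (K {a} {b}) K
    I-cong    : ∀ {a} → R _ (I {a}) I
    S'-cong   : ∀ {a b c} {t s : Tr (a ⇒ b ⇒ c)} → R _ t s → R _ (S' t) (S' s)
    S''-cong  : ∀ {a b c} {t₁ s₁ : Tr (a ⇒ b ⇒ c)} {t₂ s₂ : Tr (a ⇒ b)} →
                R _ t₁ s₁ → R _ t₂ s₂ → R _ (S'' t₁ t₂) (S'' s₁ s₂)
    K'-cong   : ∀ {a b} {t s : Tr a} → R a t s → R (b ⇒ a) (K' t) (K' s)
    app-cong  : ∀ {a b} {t₁ s₁ : Tr (a ⇒ b)} {t₂ s₂ : Tr a} →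
                R _ t₁ s₁ → R a t₂ s₂ → R b (app t₁ t₂) (app s₁ s₂)
    inl-cong  : ∀ {a b} {t s : Tr a} → R a t s → R (a ⊞ b) (inl t) (inl s)
    inr-cong  : ∀ {a b} {t s : Tr b} → R b t s → R (a ⊞ b) (inr t) (inr s)
    case-cong : ∀ {a b c} {t₁ s₁ : Tr (a ⊞ b)} {t₂ s₂ : Tr (a ⇒ c)} {t₃ s₃ : Tr (b ⇒ c)} →
                R _ t₁ s₁ → R _ t₂ s₂ → R _ t₃ s₃ → R c (case t₁ t₂ t₃) (case s₁ s₂ s₃)
    pair-cong : ∀ {a b} {t₁ s₁ : Tr a} {t₂ s₂ : Tr b} →
                R a t₁ s₁ → R b t₂ s₂ → R (a ⊠ b) (pair t₁ t₂) (pair s₁ s₂)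
    fst-cong  : ∀ {a b} {t s : Tr (a ⊠ b)} → R _ t s → R a (fst t) (fst s)
    snd-cong  : ∀ {a b} {t s : Tr (a ⊠ b)} → R _ t s → R b (snd t) (snd s)
    fold-cong   : ∀ {τ : Ty 1} {t s : Tr (τ [ μ τ ])} → R (τ [ μ τ ]) t s → R (μ τ) (fold t) (fold s)
    unfold-cong : ∀ {τ : Ty 1} {t s : Tr (μ τ)} → R (μ τ) t s → R (τ [ μ τ ]) (unfold {τ} t) (unfold s)

-- Each operation symbol of Tr is either an introduction form (S, K, I, S', S'', K', inl, inr,
-- pair, fold), which performs only labelled transitions, or an elimination form (app, case,
-- fst, snd, unfold), which performs only silent ones.  Hence at step n+1 an introduction form
-- is related by 𝓥 alone and an elimination form by 𝓔 alone, and each of these clauses is met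
-- using the step-n relatedness of the arguments together with the congruence property of 𝓛ⁿ.
-- Induction on n gives every finite stage; 𝓛^ω is an intersection of congruences.
module Submission where

open import Defs
open import Data.Nat using (ℕ; zero; suc)
open import Data.Unit using (⊤; tt)
open import Data.Empty using (⊥; ⊥-elim)
open import Data.Product using (_×_; _,_; proj₁; proj₂)
open import Relation.Nullary using (¬_)
open import Relation.Binary.Construct.Closure.ReflexiveTransitive using (ε; _◅_; _◅◅_; gmap)

Next : TRel → TRel
Next R a t s = R a t s × 𝓔 R a t s × 𝓥 R R a t s

IsElimination : ∀ {a} → Tr a → Set
IsElimination (app _ _)    = ⊤
IsElimination (case _ _ _) = ⊤
IsElimination (fst _)      = ⊤
IsElimination (snd _)      = ⊤
IsElimination (unfold _)   = ⊤
IsElimination _            = ⊥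

𝓔-irreducible : ∀ {R a} {t s : Tr a} → (∀ {t'} → ¬ t ⟶ t') → 𝓔 R a t s
𝓔-irreducible irr t' st = ⊥-elim (irr st)

𝓥-elimination : ∀ {Q R} a {t s : Tr a} → IsElimination t → 𝓥 Q R a t s
𝓥-elimination (var ())
𝓥-elimination (a ⊞ b) e = (λ { _ inl-step → ⊥-elim e }) , (λ { _ inr-step → ⊥-elim e })
𝓥-elimination (a ⊠ b) e = λ { _ _ pair-step₁ _ → ⊥-elim e }
𝓥-elimination (μ τ)   e = λ { _ fold-step → ⊥-elim e }
𝓥-elimination (a ⇒ b) e = λ
  { _ _ _ _ S-step   → ⊥-elim e
  ; _ _ _ _ S'-step  → ⊥-elim e
  ; _ _ _ _ S''-step → ⊥-elim e
  ; _ _ _ _ K-step   → ⊥-elim e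
  ; _ _ _ _ K'-step  → ⊥-elim e
  ; _ _ _ _ I-step   → ⊥-elim e
  }

full-congruence : Congruence (λ _ _ _ → ⊤)
full-congruence = record
  { S-cong = tt ; K-cong = tt ; I-cong = tt
  ; S'-cong = λ _ → tt ; S''-cong = λ _ _ → tt ; K'-cong = λ _ → tt
  ; app-cong = λ _ _ → tt ; inl-cong = λ _ → tt ; inr-cong = λ _ → tt
  ; case-cong = λ _ _ _ → tt ; pair-cong = λ _ _ → tt
  ; fst-cong = λ _ → tt ; snd-cong = λ _ → tt
  ; fold-cong = λ _ → tt ; unfold-cong = λ _ → tt
  }

⋂-congruence : {R : ℕ → TRel} → (∀ n → Congruence (R n)) → Congruence (λ a t s → ∀ n → R n a t s)
⋂-congruence C = record
  { S-cong = λ n → S-cong (C n) ; K-cong = λ n → K-cong (C n) ; I-cong = λ n → I-cong (C n)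
  ; S'-cong = λ r n → S'-cong (C n) (r n)
  ; S''-cong = λ r q n → S''-cong (C n) (r n) (q n)
  ; K'-cong = λ r n → K'-cong (C n) (r n)
  ; app-cong = λ r q n → app-cong (C n) (r n) (q n)
  ; inl-cong = λ r n → inl-cong (C n) (r n)
  ; inr-cong = λ r n → inr-cong (C n) (r n)
  ; case-cong = λ r q p n → case-cong (C n) (r n) (q n) (p n)
  ; pair-cong = λ r q n → pair-cong (C n) (r n) (q n)
  ; fst-cong = λ r n → fst-cong (C n) (r n)
  ; snd-cong = λ r n → snd-cong (C n) (r n)
  ; fold-cong = λ r n → fold-cong (C n) (r n)
  ; unfold-cong = λ r n → unfold-cong (C n) (r n)
  }
  where open Congruence

module _ {R : TRel} (R-cong : Congruence R) where
  open Congruence R-cong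

  S-Next : ∀ {a b c} → Next R _ (S {a} {b} {c}) S
  S-Next = S-cong , 𝓔-irreducible {R} (λ ()) ,
    λ { _ e₂ q _ S-step → S' e₂ , (S , ε , S-step) , S'-cong q }

  K-Next : ∀ {a b} → Next R _ (K {a} {b}) K
  K-Next = K-cong , 𝓔-irreducible {R} (λ ()) ,
    λ { _ e₂ q _ K-step → K' e₂ , (K , ε , K-step) , K'-cong q }

  I-Next : ∀ {a} → Next R _ (I {a}) I
  I-Next = I-cong , 𝓔-irreducible {R} (λ ()) ,
    λ { _ e₂ q _ I-step → e₂ , (I , ε , I-step) , q }

  S'-Next : ∀ {a b c} {t s : Tr (a ⇒ b ⇒ c)} → Next R _ t s → Next R _ (S' t) (S' s)
  S'-Next {s = s} (r , _ , _) = S'-cong r , 𝓔-irreducible {R} (λ ()) ,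
    λ { _ e₂ q _ S'-step → S'' s e₂ , (S' s , ε , S'-step) , S''-cong r q }

  S''-Next : ∀ {a b c} {t₁ s₁ : Tr (a ⇒ b ⇒ c)} {t₂ s₂ : Tr (a ⇒ b)} →
             Next R _ t₁ s₁ → Next R _ t₂ s₂ → Next R _ (S'' t₁ t₂) (S'' s₁ s₂)
  S''-Next (r₁ , _ , _) (r₂ , _ , _) = S''-cong r₁ r₂ , 𝓔-irreducible {R} (λ ()) ,
    λ { _ _ q _ S''-step → _ , (_ , ε , S''-step) , app-cong (app-cong r₁ q) (app-cong r₂ q) }

  K'-Next : ∀ {a b} {t s : Tr a} → Next R a t s → Next R (b ⇒ a) (K' t) (K' s)
  K'-Next {s = s} (r , _ , _) = K'-cong r , 𝓔-irreducible {R} (λ ()) ,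
    λ { _ _ _ _ K'-step → s , (_ , ε , K'-step) , r }

  inl-Next : ∀ {a b} {t s : Tr a} → Next R a t s → Next R (a ⊞ b) (inl t) (inl s)
  inl-Next {s = s} (r , _ , _) = inl-cong r , 𝓔-irreducible {R} (λ ()) ,
    (λ { _ inl-step → s , (_ , ε , inl-step) , r }) , (λ { _ () })

  inr-Next : ∀ {a b} {t s : Tr b} → Next R b t s → Next R (a ⊞ b) (inr t) (inr s)
  inr-Next {s = s} (r , _ , _) = inr-cong r , 𝓔-irreducible {R} (λ ()) ,
    (λ { _ () }) , (λ { _ inr-step → s , (_ , ε , inr-step) , r })

  pair-Next : ∀ {a b} {t₁ s₁ : Tr a} {t₂ s₂ : Tr b} →
              Next R a t₁ s₁ → Next R b t₂ s₂ → Next R (a ⊠ b) (pair t₁ t₂) (pair s₁ s₂)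
  pair-Next {s₁ = s₁} {s₂ = s₂} (r₁ , _ , _) (r₂ , _ , _) = pair-cong r₁ r₂ , 𝓔-irreducible {R} (λ ()) ,
    λ { _ _ pair-step₁ pair-step₂ →
        s₁ , s₂ , (_ , ε , pair-step₁) , (_ , ε , pair-step₂) , r₁ , r₂ }

  fold-Next : ∀ {τ : Ty 1} {t s : Tr (τ [ μ τ ])} →
              Next R (τ [ μ τ ]) t s → Next R (μ τ) (fold t) (fold s)
  fold-Next {s = s} (r , _ , _) = fold-cong r , 𝓔-irreducible {R} (λ ()) ,
    λ { _ fold-step → s , (_ , ε , fold-step) , r }

  app-Next : ∀ {a b} {t₁ s₁ : Tr (a ⇒ b)} {t₂ s₂ : Tr a} →
             Next R _ t₁ s₁ → Next R a t₂ s₂ → Next R b (app t₁ t₂) (app s₁ s₂)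
  app-Next {b = b} {t₁} {s₁} {t₂} {s₂} (r₁ , e₁ , v₁) (r₂ , _ , _) =
    app-cong r₁ r₂ , silent , 𝓥-elimination b tt
    where
    silent : 𝓔 R b (app t₁ t₂) (app s₁ s₂)
    silent _ (app-l st) with e₁ _ st
    ... | s₁' , ss , r = app s₁' s₂ , gmap (λ x → app x s₂) app-l ss , app-cong r r₂
    silent _ (app-β tr) with v₁ t₂ s₂ r₂ _ tr
    ... | s' , (_ , ss , tr') , r = s' , gmap (λ x → app x s₂) app-l ss ◅◅ app-β tr' ◅ ε , r

  case-Next : ∀ {a b c} {t₁ s₁ : Tr (a ⊞ b)} {t₂ s₂ : Tr (a ⇒ c)} {t₃ s₃ : Tr (b ⇒ c)} →
              Next R _ t₁ s₁ → Next R _ t₂ s₂ → Next R _ t₃ s₃ →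
              Next R c (case t₁ t₂ t₃) (case s₁ s₂ s₃)
  case-Next {c = c} {t₁} {s₁} {t₂} {s₂} {t₃} {s₃} (r₁ , e₁ , v₁) (r₂ , _ , _) (r₃ , _ , _) =
    case-cong r₁ r₂ r₃ , silent , 𝓥-elimination c tt
    where
    silent : 𝓔 R c (case t₁ t₂ t₃) (case s₁ s₂ s₃)
    silent _ (case-l st) with e₁ _ st
    ... | s₁' , ss , r = case s₁' s₂ s₃ , gmap (λ x → case x s₂ s₃) case-l ss , case-cong r r₂ r₃
    silent _ (case-inl tr) with proj₁ v₁ _ tr
    ... | s' , (_ , ss , tr') , r =
      app s₂ s' , gmap (λ x → case x s₂ s₃) case-l ss ◅◅ case-inl tr' ◅ ε , app-cong r₂ r
    silent _ (case-inr tr) with proj₂ v₁ _ tr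
    ... | s' , (_ , ss , tr') , r =
      app s₃ s' , gmap (λ x → case x s₂ s₃) case-l ss ◅◅ case-inr tr' ◅ ε , app-cong r₃ r

  fst-Next : ∀ {a b} {t s : Tr (a ⊠ b)} → Next R _ t s → Next R a (fst t) (fst s)
  fst-Next {a} {t = t} {s} (r₀ , e₀ , v₀) = fst-cong r₀ , silent , 𝓥-elimination a tt
    where
    silent : 𝓔 R a (fst t) (fst s)
    silent _ (fst-l st) with e₀ _ st
    ... | s' , ss , r = fst s' , gmap fst fst-l ss , fst-cong r
    silent _ (fst-β pair-step₁) with v₀ _ _ pair-step₁ pair-step₂
    ... | s₁ , _ , (_ , ss , tr) , _ , r , _ = s₁ , gmap fst fst-l ss ◅◅ fst-β tr ◅ ε , r

  snd-Next : ∀ {a b} {t s : Tr (a ⊠ b)} → Next R _ t s → Next R b (snd t) (snd s)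
  snd-Next {b = b} {t = t} {s} (r₀ , e₀ , v₀) = snd-cong r₀ , silent , 𝓥-elimination b tt
    where
    silent : 𝓔 R b (snd t) (snd s)
    silent _ (snd-l st) with e₀ _ st
    ... | s' , ss , r = snd s' , gmap snd snd-l ss , snd-cong r
    silent _ (snd-β pair-step₂) with v₀ _ _ pair-step₁ pair-step₂
    ... | _ , s₂ , _ , (_ , ss , tr) , _ , r = s₂ , gmap snd snd-l ss ◅◅ snd-β tr ◅ ε , r

  unfold-Next : ∀ {τ : Ty 1} {t s : Tr (μ τ)} →
                Next R (μ τ) t s → Next R (τ [ μ τ ]) (unfold {τ} t) (unfold s)
  unfold-Next {τ} {t} {s} (r₀ , e₀ , v₀) = unfold-cong r₀ , silent , 𝓥-elimination (τ [ μ τ ]) tt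
    where
    silent : 𝓔 R (τ [ μ τ ]) (unfold t) (unfold s)
    silent _ (unfold-l st) with e₀ _ st
    ... | s' , ss , r = unfold s' , gmap unfold unfold-l ss , unfold-cong r
    silent _ (unfold-β tr) with v₀ _ tr
    ... | s' , (_ , ss , tr') , r = s' , gmap unfold unfold-l ss ◅◅ unfold-β tr' ◅ ε , r

  Next-congruence : Congruence (Next R)
  Next-congruence = record
    { S-cong = S-Next ; K-cong = K-Next ; I-cong = I-Next
    ; S'-cong = S'-Next ; S''-cong = S''-Next ; K'-cong = K'-Next
    ; app-cong = app-Next ; inl-cong = inl-Next ; inr-cong = inr-Next
    ; case-cong = case-Next ; pair-cong = pair-Next
    ; fst-cong = fst-Next ; snd-cong = snd-Next
    ; fold-cong = fold-Next ; unfold-cong = unfold-Next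
    }

𝓛ⁿ-congruence : ∀ n → Congruence (𝓛ⁿ n)
𝓛ⁿ-congruence zero    = full-congruence
𝓛ⁿ-congruence (suc n) = Next-congruence (𝓛ⁿ-congruence n)

theorem3p4 : (α : Ord≤ω) → Congruence (𝓛 α)
theorem3p4 (fin n) = 𝓛ⁿ-congruence n
theorem3p4 ω       = ⋂-congruence 𝓛ⁿ-congruence
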